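{- Let $g_1,g_2$ be positive integers, let $G$ be an abelian group and $H$ a subgroup of $G$. (1) Suppose $\{a_1,\dots,a_s\}$ ($s$ distinct elements) is a $g_1$-additive basis of $H$ and $\{b_1+H,\dots,b_t+H\}$ ($t$ distinct cosets) is a $g_2$-additive basis of $G/H$. Then $\{a_k+b_i : 1\le k\le s,\ 1\le i\le t\}$ is a $g_1g_2$-additive basis of $G$. Consequently (for $G$ finite, whenever the quantities on the right exist), $\nu_{g_1g_2}(G)\le \nu_{g_1}(H)\,\nu_{g_2}(G/H)$. (2) Suppose $\{a_1,\dots,a_s\}$ is a $g_1$-difference basis of $H$ and $\{b_1+H,\dots,b_t+H\}$ is a $g_2$-difference basis of $G/H$. Then $\{a_k+b_i : 1\le k\le s,\ 1\le i\le t\}$ is a $g_1g_2$-difference basis of $G$. Consequently (for $G$ finite, whenever the quantities on the right exist), $\eta_{g_1g_2}(G)\le \eta_{g_1}(H)\,\eta_{g_2}(G/H)$.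
   Context: For an abelian group $G$ and $A\subseteq G$, let $r_{A+A}(x)=|\{(a,b)\in A\times A: a+b=x\}|$ and $r_{A-A}(x)=|\{(a,b)\in A\times A: a-b=x\}|$. For a positive integer $g$, $A$ is a $g$-additive basis of $G$ if $r_{A+A}(x)\ge g$ for all $x\in G$ and a $g$-difference basis of $G$ if $r_{A-A}(x)\ge g$ for all $x\in G$. For finite $G$, $\nu_g(G)$ (resp. $\eta_g(G)$) is the minimum size of a $g$-additive (resp. $g$-difference) basis of $G$. -}

module Defs where

open import Level using (Level; _⊔_; suc)
open import Data.Nat using (ℕ)
open import Data.Fin using (Fin)
open import Data.Product using (Σ; _×_; _,_; proj₁; proj₂)
open import Relation.Binary.PropositionalEquality using (_≡_)
open import Function.Definitions using (Injective)
open import Algebra.Bundles using (AbelianGroup)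

AtLeast : ∀ {a q} {I : Set a} → ℕ → (I → Set q) → Set (a ⊔ q)
AtLeast {I = I} g Q = Σ (Fin g → I) λ f → Injective _≡_ _≡_ f × (∀ m → Q (f m))

module _ {c ℓ : Level} (G : AbelianGroup c ℓ) where
  open AbelianGroup G

  record Subgroup (p : Level) : Set (c ⊔ ℓ ⊔ suc p) where
    field
      _∈H : Carrier → Set p
      ∈-resp : ∀ {x y} → x ≈ y → x ∈H → y ∈H
      ε∈ : ε ∈H
      ∙∈ : ∀ {x y} → x ∈H → y ∈H → (x ∙ y) ∈H
      ⁻¹∈ : ∀ {x} → x ∈H → (x ⁻¹) ∈H

  -- A finite subset {f i | i ∈ I} of G given by an indexing family
  -- f : I → G whose elements are pairwise distinct.
  Distinct : ∀ {a} {I : Set a} → (I → Carrier) → Set (a ⊔ ℓ)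
  Distinct f = Injective _≡_ _≈_ f

  -- r_{A+A}(x) ≥ g   (pairs (a,b) ∈ A × A counted via their indices)
  r+≥ : ∀ {a} {I : Set a} → (I → Carrier) → Carrier → ℕ → Set (a ⊔ ℓ)
  r+≥ f x g = AtLeast g λ (pq : _ × _) → (f (proj₁ pq) ∙ f (proj₂ pq)) ≈ x

  r-≥ : ∀ {a} {I : Set a} → (I → Carrier) → Carrier → ℕ → Set (a ⊔ ℓ)
  r-≥ f x g = AtLeast g λ (pq : _ × _) → (f (proj₁ pq) ∙ (f (proj₂ pq) ⁻¹)) ≈ x

  IsAddBasis : ∀ {a} {I : Set a} → ℕ → (I → Carrier) → Set (a ⊔ c ⊔ ℓ)
  IsAddBasis g f = Distinct f × (∀ x → r+≥ f x g)

  IsDiffBasis : ∀ {a} {I : Set a} → ℕ → (I → Carrier) → Set (a ⊔ c ⊔ ℓ)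
  IsDiffBasis g f = Distinct f × (∀ x → r-≥ f x g)

  module _ {p : Level} (H : Subgroup p) where
    open Subgroup H

    IsAddBasisOfSub : ∀ {a} {I : Set a} → ℕ → (I → Carrier) → Set (a ⊔ c ⊔ ℓ ⊔ p)
    IsAddBasisOfSub g f =
      (∀ i → f i ∈H) × Distinct f × (∀ h → h ∈H → r+≥ f h g)

    IsDiffBasisOfSub : ∀ {a} {I : Set a} → ℕ → (I → Carrier) → Set (a ⊔ c ⊔ ℓ ⊔ p)
    IsDiffBasisOfSub g f =
      (∀ i → f i ∈H) × Distinct f × (∀ h → h ∈H → r-≥ f h g)

    -- Equality in the quotient G/H:  x + H = y + H  iff  x - y ∈ H.
    _≈H_ : Carrier → Carrier → Set p
    x ≈H y = (x ∙ (y ⁻¹)) ∈H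

    IsAddBasisOfQuot : ∀ {a} {I : Set a} → ℕ → (I → Carrier) → Set (a ⊔ c ⊔ p)
    IsAddBasisOfQuot g f =
      Injective _≡_ _≈H_ f ×
      (∀ x → AtLeast g λ (ij : _ × _) → (f (proj₁ ij) ∙ f (proj₂ ij)) ≈H x)

    IsDiffBasisOfQuot : ∀ {a} {I : Set a} → ℕ → (I → Carrier) → Set (a ⊔ c ⊔ p)
    IsDiffBasisOfQuot g f =
      Injective _≡_ _≈H_ f ×
      (∀ x → AtLeast g λ (ij : _ × _) → (f (proj₁ ij) ∙ (f (proj₂ ij) ⁻¹)) ≈H x)

{-# OPTIONS --safe #-}
module Submission where

open import Defs
open import Level using (Level)
open import Data.Nat using (ℕ; _*_; _≥_)
open import Data.Fin using (Fin)
open import Data.Fin.Properties using (*↔×)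
open import Data.Product using (_×_; proj₁; proj₂; _,_; uncurry)
open import Algebra.Bundles using (AbelianGroup)
open import Algebra.Core using (Op₂)
open import Function using (_∘_; Injection)
open import Function.Definitions using (Injective)
open import Function.Properties.Inverse using (↔⇒↣)
open import Relation.Binary.PropositionalEquality using (_≡_; refl; cong)

-- In an abelian group both ⊙ = + and ⊙ = − satisfy (u + v) ⊙ (u′ + v′) = (u ⊙ u′) + (v ⊙ v′).
-- Hence for each of the g₂ pairs (i , j) with b i ⊙ b j ≡ x (mod H), and each of the g₁ pairs
-- (k , l) with a k ⊙ a l = x − (b i ⊙ b j) ∈ H, the pair (a k + b i , a l + b j) represents x,
-- and distinct choices give distinct index pairs.  The elements a k + b i are distinct since
-- the a k lie in H and the b i in distinct cosets of H.

module _ {a b q r : Level} {I : Set a} {J : Set b} where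

  AtLeast-map : ∀ {g} {Q : I → Set q} {R : J → Set r} (h : I → J) → Injective _≡_ _≡_ h →
                (∀ i → Q i → R (h i)) → AtLeast g Q → AtLeast g R
  AtLeast-map h h-injective Q⇒R (f , f-injective , Q-f) =
    h ∘ f , f-injective ∘ h-injective , λ m → Q⇒R (f m) (Q-f m)

  AtLeast-* : ∀ {g₁ g₂} {Q : J → Set q} {R : I → J → Set r} → AtLeast g₂ Q →
              (∀ {j} → Q j → AtLeast g₁ (λ i → R i j)) → AtLeast (g₁ * g₂) (uncurry R)
  AtLeast-* {g₁} {g₂} {R = R} (f , f-injective , Q-f) fibre =
    pick ∘ to , to-injective ∘ pick-injective , R-pick ∘ to
    where
    open Injection (↔⇒↣ (*↔× {g₁} {g₂})) using (to) renaming (injective to to-injective)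

    pick : Fin g₁ × Fin g₂ → I × J
    pick (m₁ , m₂) = proj₁ (fibre (Q-f m₂)) m₁ , f m₂

    pick-injective : Injective _≡_ _≡_ pick
    pick-injective {_ , m₂} {_ , _} e with f-injective (cong proj₂ e)
    ... | refl = cong (_, m₂) (proj₁ (proj₂ (fibre (Q-f m₂))) (cong proj₁ e))

    R-pick : ∀ m → uncurry R (pick m)
    R-pick (m₁ , m₂) = proj₂ (proj₂ (fibre (Q-f m₂))) m₁

module _ {a b c d : Level} {A : Set a} {B : Set b} {C : Set c} {D : Set d} where

  transpose : (A × B) × (C × D) → (A × C) × (B × D)
  transpose ((x , y) , (z , w)) = (x , z) , (y , w)

  transpose-injective : Injective _≡_ _≡_ transpose
  transpose-injective {(_ , _) , (_ , _)} {(_ , _) , (_ , _)} refl = refl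

module _ {c ℓ : Level} (G : AbelianGroup c ℓ) where
  open AbelianGroup G
  open import Algebra.Definitions _≈_ using (Interchangable)
  open import Algebra.Properties.AbelianGroup G
  open import Algebra.Properties.CommutativeSemigroup commutativeSemigroup using (interchange)
  open import Relation.Binary.Reasoning.Setoid setoid

  -‿∙-interchange : Interchangable _-_ _∙_
  -‿∙-interchange w x y z = begin
    (w ∙ x) - (y ∙ z)        ≈⟨ ∙-congˡ (⁻¹-∙-comm y z) ⟨
    (w ∙ x) ∙ (y ⁻¹ ∙ z ⁻¹)  ≈⟨ interchange w x (y ⁻¹) (z ⁻¹) ⟩
    (w - y) ∙ (x - z)        ∎

  x∙y≈u∙v⇒y-v≈u-x : ∀ {x y u v} → x ∙ y ≈ u ∙ v → y - v ≈ u - x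
  x∙y≈u∙v⇒y-v≈u-x {x} {y} {u} {v} e = begin
    y - v              ≈⟨ identityˡ (y - v) ⟨
    ε ∙ (y - v)        ≈⟨ ∙-congʳ (inverseʳ x) ⟨
    (x - x) ∙ (y - v)  ≈⟨ -‿∙-interchange x y x v ⟨
    (x ∙ y) - (x ∙ v)  ≈⟨ ∙-congʳ e ⟩
    (u ∙ v) - (x ∙ v)  ≈⟨ -‿∙-interchange u v x v ⟩
    (u - x) ∙ (v - v)  ≈⟨ ∙-congˡ (inverseʳ v) ⟩
    (u - x) ∙ ε        ≈⟨ identityʳ (u - x) ⟩
    u - x              ∎

  pairwise : ∀ {i} {I : Set i} → Op₂ Carrier → (I → Carrier) → I × I → Carrier
  pairwise _⊙_ f ij = f (proj₁ ij) ⊙ f (proj₂ ij)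

  _⊞_ : ∀ {k i} {K : Set k} {I : Set i} → (K → Carrier) → (I → Carrier) → K × I → Carrier
  (a ⊞ b) ki = a (proj₁ ki) ∙ b (proj₂ ki)

  module _ {p : Level} (H : Subgroup G p) where
    open Subgroup H

    ≈H-sym : ∀ {x y} → _≈H_ G H x y → _≈H_ G H y x
    ≈H-sym {x} {y} x-y∈H = ∈-resp (⁻¹-anti-homo‿- x y) (⁻¹∈ x-y∈H)

    module _ {k i : Level} {K : Set k} {I : Set i} (a : K → Carrier) (b : I → Carrier) where

      ⊞-distinct : (∀ k → a k ∈H) → Distinct G a → Injective _≡_ (_≈H_ G H) b → Distinct G (a ⊞ b)
      ⊞-distinct a∈H a-injective b-injective {k , i} {k′ , _} e
        with b-injective (∈-resp (sym (x∙y≈u∙v⇒y-v≈u-x e)) (∙∈ (a∈H k′) (⁻¹∈ (a∈H k))))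
      ... | refl = cong (_, i) (a-injective (∙-cancelʳ (b i) (a k) (a k′) e))

      ⊞-represents : ∀ {g₁ g₂} (_⊙_ : Op₂ Carrier) → Interchangable _⊙_ _∙_ →
        (∀ h → h ∈H → AtLeast g₁ λ kl → pairwise _⊙_ a kl ≈ h) →
        (∀ x → AtLeast g₂ λ ij → _≈H_ G H (pairwise _⊙_ b ij) x) →
        ∀ x → AtLeast (g₁ * g₂) λ pq → pairwise _⊙_ (a ⊞ b) pq ≈ x
      ⊞-represents _⊙_ ⊙-∙-interchange a-represents b-represents x =
        AtLeast-map transpose transpose-injective lift
          (AtLeast-* {R = λ kl ij → pairwise _⊙_ a kl ≈ x - pairwise _⊙_ b ij} (b-represents x)
            λ {ij} bij≈Hx → a-represents (x - pairwise _⊙_ b ij) (≈H-sym bij≈Hx))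
        where
        lift : ∀ klij → pairwise _⊙_ a (proj₁ klij) ≈ x - pairwise _⊙_ b (proj₂ klij) →
               pairwise _⊙_ (a ⊞ b) (transpose klij) ≈ x
        lift ((k , l) , (i , j)) e = begin
          (a k ∙ b i) ⊙ (a l ∙ b j)        ≈⟨ ⊙-∙-interchange (a k) (b i) (a l) (b j) ⟩
          (a k ⊙ a l) ∙ (b i ⊙ b j)        ≈⟨ ∙-congʳ e ⟩
          (x - (b i ⊙ b j)) ∙ (b i ⊙ b j)  ≈⟨ //-rightDividesˡ (b i ⊙ b j) x ⟩
          x                                ∎

lemma2p1 : ∀ {c ℓ p : Level} (G : AbelianGroup c ℓ) (H : Subgroup G p)
    (g₁ g₂ : ℕ) → g₁ ≥ 1 → g₂ ≥ 1 → (s t : ℕ)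
    (a : Fin s → AbelianGroup.Carrier G) (b : Fin t → AbelianGroup.Carrier G) →
    ((IsAddBasisOfSub G H g₁ a → IsAddBasisOfQuot G H g₂ b →
        IsAddBasis G (g₁ * g₂)
          (λ (ki : Fin s × Fin t) → AbelianGroup._∙_ G (a (proj₁ ki)) (b (proj₂ ki))))
    × (IsDiffBasisOfSub G H g₁ a → IsDiffBasisOfQuot G H g₂ b →
        IsDiffBasis G (g₁ * g₂)
          (λ (ki : Fin s × Fin t) → AbelianGroup._∙_ G (a (proj₁ ki)) (b (proj₂ ki)))))
lemma2p1 G H g₁ g₂ _ _ s t a b =
  (λ (a∈H , a-injective , a-basis) (b-injective , b-basis) →
     ⊞-distinct G H a b a∈H a-injective b-injective ,
     ⊞-represents G H a b _∙_ interchange a-basis b-basis) ,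
  (λ (a∈H , a-injective , a-basis) (b-injective , b-basis) →
     ⊞-distinct G H a b a∈H a-injective b-injective ,
     ⊞-represents G H a b _-_ (-‿∙-interchange G) a-basis b-basis)
  where
  open AbelianGroup G
  open import Algebra.Properties.CommutativeSemigroup commutativeSemigroup using (interchange)
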